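{- Let $G$ be a bidirected graph and let $\{u\alpha,v\beta\}$ be an ultrabubble in the splitting sense (Definition A below). Then its ultrabubble component $B$ according to Definition A is equal to the graph $B'$ consisting of $u$, $v$ and all nodes and edges lying on $u\alpha$-$v\hat{\beta}$-paths.
   Context: Bidirected graphs: $G=(V,E)$, finite node set; sign $\alpha\in\{+,-\}$ with opposite $\hat{+}=-$, $\hat{ - }=+$; signed node $v\alpha$; edges are unordered pairs of signed nodes ($u=v$ allowed). A walk is a sequence $v_1\alpha_1,\dots,v_\ell\alpha_\ell$ with $\{v_i\alpha_i,v_{i+1}\hat{\alpha}_{i+1}\}\in E$ (the edges on the walk); a path is a walk in which no node appears twice (with either sign); a cycloid is a $v\alpha$-$v\beta$-walk with at least one edge ($\alpha,\beta$ arbitrary). A tip is a node whose incident edges all contain the same one of its two signed nodes. Splitting a signed node $v\alpha$: add a new node $v'$ and replace every occurrence of $v\hat{\alpha}$ in edges by $v'\hat{\alpha}$. Definition A: let $u\neq v$. $\{u\alpha,v\beta\}$ is separable if the graph obtained by splitting $u\alpha$ and $v\beta$ has a connected component $B$ containing $u$ and $v$ but not $u'$ and $v'$; $B$ is the ultrabubble component. It is an ultrabubble if it is separable and (b) no node of $V(B)\setminus\{u,v\}$ is a tip, (c) $B$ contains no cycloid, (d) no signed node $w\gamma$ with $w\in V(B)\setminus\{u,v\}$ is such that both $\{u\alpha,w\gamma\}$ and $\{w\hat{\gamma},v\beta\}$ are separable. -}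

module Defs where

open import Data.Nat using (ℕ; suc)
open import Data.Fin using (Fin; fromℕ; inject₁) renaming (_≟_ to _≟F_)
open import Data.Product using (Σ; ∃; ∃-syntax; _×_; _,_; proj₁; proj₂)
open import Data.Sum using (_⊎_)
open import Data.List using (List; []; _∷_; map)
open import Data.List.Membership.Propositional using (_∈_)
open import Data.List.Relation.Unary.All using (All)
open import Data.List.Relation.Unary.Unique.Propositional using (Unique)
open import Data.Unit using (⊤)
open import Data.Empty using (⊥)
open import Relation.Binary.PropositionalEquality using (_≡_; _≢_; refl)
open import Relation.Nullary using (¬_; Dec; yes; no)
open import Relation.Binary.Construct.Closure.ReflexiveTransitive using (Star)
open import Function.Bundles using (_⇔_)

data Sign : Set where
  pos neg : Sign

opp : Sign → Sign
opp pos = neg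
opp neg = pos

_≟S_ : (α β : Sign) → Dec (α ≡ β)
pos ≟S pos = yes refl
pos ≟S neg = no λ ()
neg ≟S pos = no λ ()
neg ≟S neg = yes refl

SNode : ℕ → Set
SNode n = Fin n × Sign

oppS : ∀ {n} → SNode n → SNode n
oppS (w , γ) = (w , opp γ)

-- Bidirected graphs on the finite node set Fin n.
-- An edge is an unordered pair of signed nodes, represented by an ordered
-- pair whose order is ignored (see HasEdge).

Graph : ℕ → Set
Graph n = List (SNode n × SNode n)

HasEdge : ∀ {n} → Graph n → SNode n → SNode n → Set
HasEdge E a b = ((a , b) ∈ E) ⊎ ((b , a) ∈ E)

-- Splitting a signed node uα: add a new node u' (the last node, fromℕ n)
-- and replace every occurrence of uα̂ in edges by u'α̂.

renameSplit : ∀ {n} → SNode n → SNode n → SNode (suc n)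
renameSplit {n} (u , α) (w , γ) with w ≟F u | γ ≟S opp α
... | yes _ | yes _ = (fromℕ n , γ)
... | _     | _     = (inject₁ w , γ)

split : ∀ {n} → Graph n → SNode n → Graph (suc n)

split E s = map (λ e → (renameSplit s (proj₁ e) , renameSplit s (proj₂ e))) E

split2 : ∀ {n} → Graph n → SNode n → SNode n → Graph (suc (suc n))
split2 E (u , α) (v , β) = split (split E (u , α)) (inject₁ v , β)

ι : ∀ {n} → Fin n → Fin (suc (suc n))
ι w = inject₁ (inject₁ w)

ιS : ∀ {n} → SNode n → SNode (suc (suc n))
ιS (w , γ) = (ι w , γ)

u′ : ∀ {n} → Fin (suc (suc n))
u′ {n} = inject₁ (fromℕ n)

v′ : ∀ {n} → Fin (suc (suc n))
v′ {n} = fromℕ (suc n)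

Adj : ∀ {n} → Graph n → Fin n → Fin n → Set
Adj E x y = ∃[ γ ] ∃[ δ ] HasEdge E (x , γ) (y , δ)

Conn : ∀ {n} → Graph n → Fin n → Fin n → Set
Conn E = Star (Adj E)

-- Definition A: separability and the ultrabubble component.
-- Connected components are the classes of Conn; "the component B
-- containing u" is { x | Conn u x }.

Separable : ∀ {n} → Graph n → SNode n → SNode n → Set
Separable E (u , α) (v , β) =
  Conn E2 (ι u) (ι v) × ¬ Conn E2 (ι u) u′ × ¬ Conn E2 (ι u) v′
  where E2 = split2 E (u , α) (v , β)

InB : ∀ {n} → Graph n → SNode n → SNode n → Fin (suc (suc n)) → Set
InB E (u , α) (v , β) x = Conn (split2 E (u , α) (v , β)) (ι u) x

EdgeOfB : ∀ {n} → Graph n → SNode n → SNode n →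
          SNode (suc (suc n)) → SNode (suc (suc n)) → Set
EdgeOfB E a b x y =
  HasEdge (split2 E a b) x y × InB E a b (proj₁ x) × InB E a b (proj₁ y)

-- Walks.  A walk v₁α₁,…,v_ℓα_ℓ (ℓ ≥ 1) is represented by its first signed
-- node x = v₁α₁ and the list ws = v₂α₂ ∷ … ∷ v_ℓα_ℓ, subject to
-- {vᵢαᵢ , v_{i+1} α̂_{i+1}} ∈ E.

Linked : ∀ {n} → Graph n → SNode n → List (SNode n) → Set
Linked E a []       = ⊤
Linked E a (b ∷ bs) = HasEdge E a (oppS b) × Linked E b bs

lastOf : ∀ {n} → SNode n → List (SNode n) → SNode n
lastOf a []       = a
lastOf a (b ∷ bs) = lastOf b bs

IsWalk : ∀ {n} → Graph n → SNode n → List (SNode n) → SNode n → Set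
IsWalk E x ws y = Linked E x ws × lastOf x ws ≡ y

IsPath : ∀ {n} → Graph n → SNode n → List (SNode n) → SNode n → Set
IsPath E x ws y = IsWalk E x ws y × Unique (map proj₁ (x ∷ ws))

NodeOn : ∀ {n} → Fin n → SNode n → List (SNode n) → Set
NodeOn w x ws = w ∈ map proj₁ (x ∷ ws)

EdgeOn : ∀ {n} → SNode n → SNode n → SNode n → List (SNode n) → Set
EdgeOn p q a []       = ⊥
EdgeOn p q a (b ∷ bs) =
  ((p ≡ a × q ≡ oppS b) ⊎ (q ≡ a × p ≡ oppS b)) ⊎ EdgeOn p q b bs

IsTip : ∀ {n} → Graph n → Fin n → Set
IsTip E w = ∃[ γ ] (∀ p q → (p , q) ∈ E → (proj₁ p ≡ w ⊎ proj₁ q ≡ w) →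
                      (p ≡ (w , γ) ⊎ q ≡ (w , γ)))

HasCycloidInB : ∀ {n} → Graph n → SNode n → SNode n → Set
HasCycloidInB E a b =
  ∃[ x ] ∃[ y ] ∃[ ws ]
    IsWalk (split2 E a b) x (y ∷ ws) (proj₁ x , proj₂ (lastOf y ws))
    × All (λ z → InB E a b (proj₁ z)) (x ∷ y ∷ ws)

Ultrabubble : ∀ {n} → Graph n → SNode n → SNode n → Set
Ultrabubble E (u , α) (v , β) =
  u ≢ v
  × Separable E (u , α) (v , β)
  × (∀ w → InB E (u , α) (v , β) (ι w) → w ≢ u → w ≢ v → ¬ IsTip E w)
  × ¬ HasCycloidInB E (u , α) (v , β)
  × ¬ (∃[ w ] ∃[ γ ] (InB E (u , α) (v , β) (ι w) × w ≢ u × w ≢ v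
          × Separable E (u , α) (w , γ) × Separable E (w , opp γ) (v , β)))

NodeOfB′ : ∀ {n} → Graph n → SNode n → SNode n → Fin n → Set
NodeOfB′ E (u , α) (v , β) w =
  w ≡ u ⊎ w ≡ v ⊎
  ∃[ ws ] (IsPath E (u , α) ws (v , opp β) × NodeOn w (u , α) ws)

EdgeOfB′ : ∀ {n} → Graph n → SNode n → SNode n → SNode n → SNode n → Set
EdgeOfB′ E (u , α) (v , β) p q =
  ∃[ ws ] (IsPath E (u , α) ws (v , opp β) × EdgeOn p q (u , α) ws)

BEqualsB′ : ∀ {n} → Graph n → SNode n → SNode n → Set
BEqualsB′ E a b =
  (∀ x → InB E a b x ⇔ (∃[ w ] (x ≡ ι w × NodeOfB′ E a b w)))
  × (∀ x y → EdgeOfB E a b x y ⇔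
       (∃[ p ] ∃[ q ] (x ≡ ιS p × y ≡ ιS q × EdgeOfB′ E a b p q)))

{-# OPTIONS --safe #-}
-- Call an edge of G a B-edge if the splitting leaves both of its signed nodes in place and its
-- ends lie in B. Since B has no tips, a walk of B-edges arriving at a node other than u and v
-- can always leave it through the opposite side; since B has no cycloid, such a walk never
-- repeats a node, so it has at most n nodes. Extending a single B-edge at one end until it
-- reaches u or v, reversing, and extending again therefore yields a path of B-edges from u to
-- v through it, which is a uα-vβ̂-path of G. Conversely, a uα-vβ̂-path never uses the signed
-- nodes uα̂ and vβ̂ that the splitting moves, so it lifts to the split graph and stays in the
-- component of u.
module Submission where

open import Defs
open import Data.Fin using (Fin; zero; suc; fromℕ; inject₁) renaming (_≟_ to _≟F_)
open import Data.Fin.Properties using (fromℕ≢inject₁; inject₁-injective; pigeonhole; <⇒≢)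
open import Data.Fin.Relation.Unary.Top using (view; ‵fromℕ; ‵inj₁; ‵inject₁)
open import Data.Nat using (ℕ; zero; suc; _≤_; _+_; _≤?_)
open import Data.Nat.Properties using (≤-trans; 1+n≰n; +-suc; m≤m+n; ≰⇒>)
open import Data.Product using (∃; ∃-syntax; ∃₂; _×_; _,_; proj₁; proj₂)
open import Data.Product.Properties using (≡-dec)
open import Data.Sum using (_⊎_; inj₁; inj₂; swap)
open import Data.List using (List; []; _∷_; map; _++_; length; lookup)
open import Data.List.Properties using (length-map)
open import Data.List.Membership.Propositional using (_∈_; find)
open import Data.List.Membership.Propositional.Properties using (∈-map⁺; ∈-map⁻; ∈-lookup)
open import Data.List.Relation.Unary.Any using (here; there; any?)
open import Data.List.Relation.Unary.All using (All; []; _∷_)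
import Data.List.Relation.Unary.All as All
open import Data.List.Relation.Unary.All.Properties using (¬Any⇒All¬) renaming (map⁺ to All-map⁺)
open import Data.List.Relation.Unary.AllPairs using ([]; _∷_)
open import Data.List.Relation.Unary.Unique.Propositional using (Unique)
open import Data.Unit using (⊤; tt)
open import Function using (_∘_; id)
open import Function.Bundles using (_⇔_; mk⇔)
open import Relation.Binary.Definitions using (Symmetric)
open import Relation.Binary.PropositionalEquality
  using (_≡_; _≢_; refl; sym; trans; cong; cong₂; subst; subst₂; module ≡-Reasoning)
open import Relation.Binary.Construct.Closure.ReflexiveTransitive using (ε; _◅_; _◅◅_)
open import Relation.Nullary using (¬_; Dec; yes; no; contradiction)
open import Relation.Nullary.Decidable using (_⊎-dec_)

opp-involutive : ∀ γ → opp (opp γ) ≡ γ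
opp-involutive pos = refl
opp-involutive neg = refl

opp-irreflexive : ∀ γ → γ ≢ opp γ
opp-irreflexive pos ()
opp-irreflexive neg ()

≡-or-≡opp : ∀ γ δ → γ ≡ δ ⊎ γ ≡ opp δ
≡-or-≡opp pos pos = inj₁ refl
≡-or-≡opp pos neg = inj₂ refl
≡-or-≡opp neg pos = inj₂ refl
≡-or-≡opp neg neg = inj₁ refl

oppS-involutive : ∀ {n} (s : SNode n) → oppS (oppS s) ≡ s
oppS-involutive (w , γ) = cong (w ,_) (opp-involutive γ)

_≟SN_ : ∀ {n} (s t : SNode n) → Dec (s ≡ t)
_≟SN_ = ≡-dec _≟F_ _≟S_

other-side : ∀ {n} {s : SNode n} {w δ} → proj₁ s ≡ w → s ≢ (w , δ) → s ≡ (w , opp δ)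
other-side {s = (w , γ)} {δ = δ} refl s≢wδ with ≡-or-≡opp γ δ
... | inj₁ refl = contradiction refl s≢wδ
... | inj₂ refl = refl

Unique⇒lookup-injective : ∀ {A : Set} {xs : List A} → Unique xs →
                          ∀ i j → lookup xs i ≡ lookup xs j → i ≡ j
Unique⇒lookup-injective (_ ∷ _)      zero    zero    _  = refl
Unique⇒lookup-injective (x∉xs ∷ _)   zero    (suc j) eq =
  contradiction eq (All.lookup x∉xs (∈-lookup j))
Unique⇒lookup-injective (x∉xs ∷ _)   (suc i) zero    eq =
  contradiction (sym eq) (All.lookup x∉xs (∈-lookup i))
Unique⇒lookup-injective (_ ∷ unique) (suc i) (suc j) eq =
  cong suc (Unique⇒lookup-injective unique i j eq)

Unique⇒length≤ : ∀ {m} (xs : List (Fin m)) → Unique xs → length xs ≤ m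
Unique⇒length≤ {m} xs unique with length xs ≤? m
... | yes ≤m = ≤m
... | no ≰m with i , j , i<j , eq ← pigeonhole (≰⇒> ≰m) (lookup xs) =
  contradiction (Unique⇒lookup-injective unique i j eq) (<⇒≢ i<j)

LinkedBy : ∀ {n} → (SNode n → SNode n → Set) → SNode n → List (SNode n) → Set
LinkedBy R a []       = ⊤
LinkedBy R a (b ∷ bs) = R a (oppS b) × LinkedBy R b bs

lastOf-++ : ∀ {n} (a : SNode n) xs ys → lastOf a (xs ++ ys) ≡ lastOf (lastOf a xs) ys
lastOf-++ a []       ys = refl
lastOf-++ a (b ∷ bs) ys = lastOf-++ b bs ys

lastOf-map : ∀ {n m} (f : SNode n → SNode m) x ws → lastOf (f x) (map f ws) ≡ f (lastOf x ws)
lastOf-map f x []       = refl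
lastOf-map f x (b ∷ bs) = lastOf-map f b bs

lastOf∈ : ∀ {n} (x : SNode n) ws → proj₁ (lastOf x ws) ∈ map proj₁ (x ∷ ws)
lastOf∈ x []       = here refl
lastOf∈ x (b ∷ bs) = there (lastOf∈ b bs)

-- The reversal of the walk x ∷ ws is oppS (lastOf x ws) ∷ revTail x ws.
revTail : ∀ {n} → SNode n → List (SNode n) → List (SNode n)
revTail x []       = []
revTail x (b ∷ bs) = revTail b bs ++ oppS x ∷ []

lastOf-revTail : ∀ {n} (x : SNode n) ws → lastOf (oppS (lastOf x ws)) (revTail x ws) ≡ oppS x
lastOf-revTail x []       = refl
lastOf-revTail x (b ∷ bs) = lastOf-++ (oppS (lastOf b bs)) (revTail b bs) (oppS x ∷ [])

module _ {n : ℕ} {R : SNode n → SNode n → Set} where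

  LinkedBy⇒Linked : ∀ {E : Graph n} {x ws} → (∀ {a b} → R a b → HasEdge E a b) →
                    LinkedBy R x ws → Linked E x ws
  LinkedBy⇒Linked {ws = []}     R⇒E _          = tt
  LinkedBy⇒Linked {ws = b ∷ bs} R⇒E (xb , bs′) = R⇒E xb , LinkedBy⇒Linked R⇒E bs′

  LinkedBy-step : ∀ {a b} → R a b → LinkedBy R a (oppS b ∷ [])
  LinkedBy-step {a} {b} ab = subst (R a) (sym (oppS-involutive b)) ab , tt

  LinkedBy-++ : ∀ {a} xs {ys} → LinkedBy R a xs → LinkedBy R (lastOf a xs) ys →
                LinkedBy R a (xs ++ ys)
  LinkedBy-++ []       _          ys′ = ys′
  LinkedBy-++ (b ∷ bs) (ab , bs′) ys′ = ab , LinkedBy-++ bs bs′ ys′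

  LinkedBy-reverse : ∀ {x ws} → Symmetric R →
                     LinkedBy R x ws → LinkedBy R (oppS (lastOf x ws)) (revTail x ws)
  LinkedBy-reverse {x} {[]}     R-sym _          = tt
  LinkedBy-reverse {x} {b ∷ bs} R-sym (xb , bs′) =
    LinkedBy-++ (revTail b bs) (LinkedBy-reverse R-sym bs′)
      (subst (λ t → LinkedBy R t (oppS x ∷ [])) (sym (lastOf-revTail b bs))
        (LinkedBy-step (R-sym xb)))

  LinkedBy-All : ∀ {P : Fin n → Set} {x ws} → (∀ {a b} → R a b → P (proj₁ b)) →
                 P (proj₁ x) → LinkedBy R x ws → All (P ∘ proj₁) (x ∷ ws)
  LinkedBy-All {ws = []}     R⇒P px _          = px ∷ []
  LinkedBy-All {ws = b ∷ bs} R⇒P px (xb , bs′) = px ∷ LinkedBy-All R⇒P (R⇒P xb) bs′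

  LinkedBy-prefix : ∀ {x ws z} → LinkedBy R x ws → z ∈ map proj₁ ws →
                    ∃₂ λ y ys → LinkedBy R x (y ∷ ys) × proj₁ (lastOf y ys) ≡ z
  LinkedBy-prefix {ws = b ∷ bs} (xb , _)   (here refl) = b , [] , (xb , tt) , refl
  LinkedBy-prefix {ws = b ∷ bs} (xb , bs′) (there z∈)  =
    let y , ys , ys′ , closes = LinkedBy-prefix bs′ z∈ in b , y ∷ ys , (xb , ys′) , closes

  LinkedBy-last-step : ∀ {x y ys} → LinkedBy R x (y ∷ ys) → ∃[ a ] R a (oppS (lastOf y ys))
  LinkedBy-last-step {x} {ys = []}    (xy , _)  = x , xy
  LinkedBy-last-step     {ys = _ ∷ _} (_ , ys′) = LinkedBy-last-step ys′

  EdgeOn⇒R : ∀ {p q x ws} → Symmetric R → LinkedBy R x ws → EdgeOn p q x ws → R p q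
  EdgeOn⇒R {ws = b ∷ bs} R-sym (xb , _)  (inj₁ (inj₁ (refl , refl))) = xb
  EdgeOn⇒R {ws = b ∷ bs} R-sym (xb , _)  (inj₁ (inj₂ (refl , refl))) = R-sym xb
  EdgeOn⇒R {ws = b ∷ bs} R-sym (_ , bs′) (inj₂ on)                   = EdgeOn⇒R R-sym bs′ on

LinkedBy-map : ∀ {n m} {R : SNode n → SNode n → Set} {R′ : SNode m → SNode m → Set}
               (f : SNode n → SNode m) → (∀ s → f (oppS s) ≡ oppS (f s)) →
               (∀ {a b} → R a b → R′ (f a) (f b)) →
               ∀ {x ws} → LinkedBy R x ws → LinkedBy R′ (f x) (map f ws)
LinkedBy-map f f-oppS R⇒R′ {ws = []} _ = tt
LinkedBy-map {R′ = R′} f f-oppS R⇒R′ {ws = b ∷ bs} (xb , bs′) =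
  subst (R′ _) (f-oppS b) (R⇒R′ xb) , LinkedBy-map f f-oppS R⇒R′ bs′

module _ {n : ℕ} {p q : SNode n} where

  EdgeOn⇒NodeOn : ∀ {x ws} → EdgeOn p q x ws → NodeOn (proj₁ p) x ws
  EdgeOn⇒NodeOn {ws = b ∷ bs} (inj₁ (inj₁ (refl , _))) = here refl
  EdgeOn⇒NodeOn {ws = b ∷ bs} (inj₁ (inj₂ (_ , refl))) = there (here refl)
  EdgeOn⇒NodeOn {ws = b ∷ bs} (inj₂ on)                = there (EdgeOn⇒NodeOn on)

  EdgeOn-step : EdgeOn p q p (oppS q ∷ [])
  EdgeOn-step = inj₁ (inj₁ (refl , sym (oppS-involutive q)))

  EdgeOn-++ˡ : ∀ {a} xs {ys} → EdgeOn p q a xs → EdgeOn p q a (xs ++ ys)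
  EdgeOn-++ˡ (b ∷ bs) (inj₁ on) = inj₁ on
  EdgeOn-++ˡ (b ∷ bs) (inj₂ on) = inj₂ (EdgeOn-++ˡ bs on)

  EdgeOn-++ʳ : ∀ {a} xs {ys} → EdgeOn p q (lastOf a xs) ys → EdgeOn p q a (xs ++ ys)
  EdgeOn-++ʳ []       on = on
  EdgeOn-++ʳ (b ∷ bs) on = inj₂ (EdgeOn-++ʳ bs on)

  EdgeOn-reverse : ∀ {x ws} → EdgeOn p q x ws → EdgeOn p q (oppS (lastOf x ws)) (revTail x ws)
  EdgeOn-reverse {x} {b ∷ bs} (inj₂ on) = EdgeOn-++ˡ (revTail b bs) (EdgeOn-reverse on)
  EdgeOn-reverse {x} {b ∷ bs} (inj₁ on) =
    EdgeOn-++ʳ (revTail b bs)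
      (subst (λ t → EdgeOn p q t (oppS x ∷ [])) (sym (lastOf-revTail b bs)) (flip on))
    where
    flip : (p ≡ x × q ≡ oppS b) ⊎ (q ≡ x × p ≡ oppS b) → EdgeOn p q (oppS b) (oppS x ∷ [])
    flip (inj₁ (refl , refl)) = inj₁ (inj₂ (refl , sym (oppS-involutive x)))
    flip (inj₂ (refl , refl)) = inj₁ (inj₁ (refl , sym (oppS-involutive x)))

module ExtendToEnds {n} (R : SNode n → SNode n → Set) (R-sym : Symmetric R) (u v : Fin n)
  (R-continues : ∀ {a b} → R a b → proj₁ a ≢ u → proj₁ a ≢ v → ∃ (R (oppS a)))
  (R-acyclic : ∀ {a y ys} → LinkedBy R a (y ∷ ys) → proj₁ (lastOf y ys) ≢ proj₁ a)
  where

  LinkedBy⇒start∉ : ∀ {x ws} → LinkedBy R x ws → All (proj₁ x ≢_) (map proj₁ ws)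
  LinkedBy⇒start∉ x∷ws = ¬Any⇒All¬ _ λ x∈ws →
    let _ , _ , cycle , closes = LinkedBy-prefix x∷ws x∈ws in R-acyclic cycle closes

  LinkedBy⇒Unique : ∀ {x ws} → LinkedBy R x ws → Unique (map proj₁ (x ∷ ws))
  LinkedBy⇒Unique {ws = []}    _              = [] ∷ []
  LinkedBy⇒Unique {ws = _ ∷ _} x∷ws@(_ , bs′) = LinkedBy⇒start∉ x∷ws ∷ LinkedBy⇒Unique bs′

  LinkedBy-length≤ : ∀ {x ws} → LinkedBy R x ws → length (x ∷ ws) ≤ n
  LinkedBy-length≤ {x} {ws} x∷ws =
    subst (_≤ n) (length-map proj₁ (x ∷ ws)) (Unique⇒length≤ _ (LinkedBy⇒Unique x∷ws))

  IsEnd : Fin n → Set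
  IsEnd w = w ≡ u ⊎ w ≡ v

  WalkFromEndThrough : SNode n → SNode n → SNode n → Set
  WalkFromEndThrough p q t =
    ∃₂ λ s ws → LinkedBy R s ws × EdgeOn p q s ws × lastOf s ws ≡ t × IsEnd (proj₁ s)

  -- k is fuel: a walk has at most n nodes (LinkedBy-length≤), so k = n always suffices.
  extend-start : ∀ k {p q} x ws → n ≤ k + length (x ∷ ws) → LinkedBy R x ws → EdgeOn p q x ws →
                 WalkFromEndThrough p q (lastOf x ws)
  extend-start k x (b ∷ bs) bound x∷ws on with (proj₁ x ≟F u) ⊎-dec (proj₁ x ≟F v)
  ... | yes end = x , b ∷ bs , x∷ws , on , refl , end
  ... | no ¬end with R-continues (proj₁ x∷ws) (¬end ∘ inj₁) (¬end ∘ inj₂)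
  extend-start zero    x (b ∷ bs) bound x∷ws on | no ¬end | c , x̂c =
    contradiction (≤-trans (LinkedBy-length≤ (R-sym x̂c , x∷ws)) bound) 1+n≰n
  extend-start (suc k) x (b ∷ bs) bound x∷ws on | no ¬end | c , x̂c =
    extend-start k c (x ∷ b ∷ bs) (subst (n ≤_) (sym (+-suc k _)) bound)
      (R-sym x̂c , x∷ws) (inj₂ on)

  WalkFromUToVThrough : SNode n → SNode n → Set
  WalkFromUToVThrough p q =
    ∃₂ λ s ws → LinkedBy R s ws × EdgeOn p q s ws × proj₁ s ≡ u × proj₁ (lastOf s ws) ≡ v

  ends⇒WalkFromUToVThrough : ∀ {p q s ws} → LinkedBy R s ws → EdgeOn p q s ws →
                             IsEnd (proj₁ s) → IsEnd (proj₁ (lastOf s ws)) →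
                             WalkFromUToVThrough p q
  ends⇒WalkFromUToVThrough {ws = []} _ () _ _
  ends⇒WalkFromUToVThrough {s = s} {ws} s∷ws on (inj₁ s≡u) (inj₂ t≡v) =
    s , ws , s∷ws , on , s≡u , t≡v
  ends⇒WalkFromUToVThrough {s = s} {ws} s∷ws on (inj₂ s≡v) (inj₁ t≡u) =
    oppS (lastOf s ws) , revTail s ws , LinkedBy-reverse R-sym s∷ws , EdgeOn-reverse on ,
    t≡u , trans (cong proj₁ (lastOf-revTail s ws)) s≡v
  ends⇒WalkFromUToVThrough {ws = _ ∷ _} s∷ws _ (inj₁ s≡u) (inj₁ t≡u) =
    contradiction (trans t≡u (sym s≡u)) (R-acyclic s∷ws)
  ends⇒WalkFromUToVThrough {ws = _ ∷ _} s∷ws _ (inj₂ s≡v) (inj₂ t≡v) =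
    contradiction (trans t≡v (sym s≡v)) (R-acyclic s∷ws)

  R⇒WalkFromUToVThrough : ∀ {p q} → R p q → WalkFromUToVThrough p q
  R⇒WalkFromUToVThrough {p} {q} pq
    with s₁ , ws₁ , walk₁ , on₁ , _ , end₁ ←
           extend-start n p (oppS q ∷ []) (m≤m+n n _) (LinkedBy-step {R = R} pq) EdgeOn-step
    with s₂ , ws₂ , walk₂ , on₂ , t₂ , end₂ ←
           extend-start n _ (revTail s₁ ws₁) (m≤m+n n _)
             (LinkedBy-reverse R-sym walk₁) (EdgeOn-reverse on₁)
    = ends⇒WalkFromUToVThrough walk₂ on₂ end₂
        (subst (IsEnd ∘ proj₁) (sym (trans t₂ (lastOf-revTail s₁ ws₁))) end₁)

Conn-snoc : ∀ {n} {E : Graph n} {x y z γ δ} → Conn E x y → HasEdge E (y , γ) (z , δ) → Conn E x z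
Conn-snoc x~y yz = x~y ◅◅ ((_ , _ , yz) ◅ ε)

¬IsTip⇒edge-at : ∀ {n} (E : Graph n) w → ¬ IsTip E w → ∀ δ → ∃[ c ] HasEdge E (w , δ) c
¬IsTip⇒edge-at E w ¬tip δ
  with any? (λ e → (proj₁ e ≟SN (w , δ)) ⊎-dec (proj₂ e ≟SN (w , δ))) E
... | yes found with (a , c) , ac∈E , at-wδ ← find found = edge at-wδ
  where
  edge : a ≡ (w , δ) ⊎ c ≡ (w , δ) → ∃[ c ] HasEdge E (w , δ) c
  edge (inj₁ refl) = c , inj₁ ac∈E
  edge (inj₂ refl) = a , inj₂ ac∈E
... | no none = contradiction (opp δ , only-opposite) ¬tip
  where
  avoid = ¬Any⇒All¬ E none
  only-opposite : ∀ p q → (p , q) ∈ E → proj₁ p ≡ w ⊎ proj₁ q ≡ w →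
                  p ≡ (w , opp δ) ⊎ q ≡ (w , opp δ)
  only-opposite p q pq∈E (inj₁ p≡w) = inj₁ (other-side p≡w (All.lookup avoid pq∈E ∘ inj₁))
  only-opposite p q pq∈E (inj₂ q≡w) = inj₂ (other-side q≡w (All.lookup avoid pq∈E ∘ inj₂))

renameSplit-other : ∀ {n} (s t : SNode n) → t ≢ oppS s →
                    renameSplit s t ≡ (inject₁ (proj₁ t) , proj₂ t)
renameSplit-other (u , α) (w , γ) t≢ŝ with w ≟F u | γ ≟S opp α
... | yes refl | yes refl = contradiction refl t≢ŝ
... | yes _    | no _     = refl
... | no _     | _        = refl

renameSplit-oppS : ∀ {n} (s : SNode n) → renameSplit s (oppS s) ≡ (fromℕ n , opp (proj₂ s))
renameSplit-oppS (u , α) with u ≟F u | opp α ≟S opp α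
... | yes _  | yes _   = refl
... | no u≢u | _       = contradiction refl u≢u
... | yes _  | no α̂≢α̂ = contradiction refl α̂≢α̂

module _ {n} {E : Graph n} (s : SNode n) where

  HasEdge-split⁺ : ∀ {a c} → HasEdge E a c → HasEdge (split E s) (renameSplit s a) (renameSplit s c)
  HasEdge-split⁺ (inj₁ ac∈E) = inj₁ (∈-map⁺ _ ac∈E)
  HasEdge-split⁺ (inj₂ ca∈E) = inj₂ (∈-map⁺ _ ca∈E)

  HasEdge-split⁻ : ∀ {a′ c′} → HasEdge (split E s) a′ c′ →
                   ∃₂ λ a c → HasEdge E a c × renameSplit s a ≡ a′ × renameSplit s c ≡ c′
  HasEdge-split⁻ (inj₁ ∈split) with (a , c) , ac∈E , refl ← ∈-map⁻ _ ∈split =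
    a , c , inj₁ ac∈E , refl , refl
  HasEdge-split⁻ (inj₂ ∈split) with (c , a) , ca∈E , refl ← ∈-map⁻ _ ∈split =
    a , c , inj₂ ca∈E , refl , refl

module UltrabubbleComponent {n} (E : Graph n) (u v : Fin n) (α β : Sign) (u≢v : u ≢ v)
  (separable : Separable E (u , α) (v , β))
  (no-tips : ∀ w → InB E (u , α) (v , β) (ι w) → w ≢ u → w ≢ v → ¬ IsTip E w)
  (no-cycloid : ¬ HasCycloidInB E (u , α) (v , β))
  where

  E₂ : Graph (suc (suc n))
  E₂ = split2 E (u , α) (v , β)

  InB₂ : Fin (suc (suc n)) → Set
  InB₂ = InB E (u , α) (v , β)

  B : Fin n → Set
  B w = InB₂ (ι w)

  u≁u′ : ¬ InB₂ u′
  u≁u′ = proj₁ (proj₂ separable)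

  u≁v′ : ¬ InB₂ v′
  u≁v′ = proj₂ (proj₂ separable)

  rename₂ : SNode n → SNode (suc (suc n))
  rename₂ t = renameSplit (inject₁ v , β) (renameSplit (u , α) t)

  HasEdge-split₂⁺ : ∀ {a c} → HasEdge E a c → HasEdge E₂ (rename₂ a) (rename₂ c)
  HasEdge-split₂⁺ = HasEdge-split⁺ _ ∘ HasEdge-split⁺ _

  HasEdge-split₂⁻ : ∀ {X Y} → HasEdge E₂ X Y →
                    ∃₂ λ a c → HasEdge E a c × rename₂ a ≡ X × rename₂ c ≡ Y
  HasEdge-split₂⁻ e₂ with _ , _ , e₁ , refl , refl ← HasEdge-split⁻ _ e₂
                     with a , c , e , refl , refl ← HasEdge-split⁻ _ e₁ = a , c , e , refl , refl

  Unsplit : SNode n → Set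
  Unsplit t = t ≢ (u , opp α) × t ≢ (v , opp β)

  unsplit-off-ends : ∀ {t} → proj₁ t ≢ u → proj₁ t ≢ v → Unsplit t
  unsplit-off-ends t≢u t≢v = t≢u ∘ cong proj₁ , t≢v ∘ cong proj₁

  unsplit-start : ∀ {s} → proj₁ s ≡ u → Unsplit s → s ≡ (u , α)
  unsplit-start s≡u (s≢uα̂ , _) = trans (other-side s≡u s≢uα̂) (cong (u ,_) (opp-involutive α))

  unsplit-end : ∀ {t} → proj₁ t ≡ v → Unsplit (oppS t) → t ≡ (v , opp β)
  unsplit-end {w , σ} refl (_ , t̂≢vβ̂) with ≡-or-≡opp σ β
  ... | inj₁ refl = contradiction refl t̂≢vβ̂
  ... | inj₂ refl = refl

  rename₂-unsplit : ∀ {t} → Unsplit t → rename₂ t ≡ ιS t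
  rename₂-unsplit {t} (t≢uα̂ , t≢vβ̂) = begin
    rename₂ t
      ≡⟨ cong (renameSplit _) (renameSplit-other (u , α) t t≢uα̂) ⟩
    renameSplit (inject₁ v , β) (inject₁ (proj₁ t) , proj₂ t)
      ≡⟨ renameSplit-other _ _ (t≢vβ̂ ∘ inject₁-cancel) ⟩
    ιS t ∎
    where
    open ≡-Reasoning
    inject₁-cancel : (inject₁ (proj₁ t) , proj₂ t) ≡ (inject₁ v , opp β) → t ≡ (v , opp β)
    inject₁-cancel eq = cong₂ _,_ (inject₁-injective (cong proj₁ eq)) (cong proj₂ eq)

  rename₂-uα̂ : rename₂ (u , opp α) ≡ (u′ , opp α)
  rename₂-uα̂ = begin
    rename₂ (u , opp α)
      ≡⟨ cong (renameSplit _) (renameSplit-oppS (u , α)) ⟩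
    renameSplit (inject₁ v , β) (fromℕ n , opp α)
      ≡⟨ renameSplit-other _ _ (fromℕ≢inject₁ ∘ cong proj₁) ⟩
    (u′ , opp α) ∎
    where open ≡-Reasoning

  rename₂-vβ̂ : rename₂ (v , opp β) ≡ (v′ , opp β)
  rename₂-vβ̂ = begin
    rename₂ (v , opp β)
      ≡⟨ cong (renameSplit _) (renameSplit-other (u , α) _ (u≢v ∘ sym ∘ cong proj₁)) ⟩
    renameSplit (inject₁ v , β) (inject₁ v , opp β)
      ≡⟨ renameSplit-oppS (inject₁ v , β) ⟩
    (v′ , opp β) ∎
    where open ≡-Reasoning

  InB₂⇒Unsplit : ∀ t → InB₂ (proj₁ (rename₂ t)) → Unsplit t
  InB₂⇒Unsplit t t∈B =
    (λ t≡uα̂ → u≁u′ (image-in-B t≡uα̂ rename₂-uα̂)) , (λ t≡vβ̂ → u≁v′ (image-in-B t≡vβ̂ rename₂-vβ̂))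
    where
    image-in-B : ∀ {s X} → t ≡ s → rename₂ s ≡ X → InB₂ (proj₁ X)
    image-in-B refl refl = t∈B

  record BEdge (p q : SNode n) : Set where
    constructor bedge
    field
      edge     : HasEdge E p q
      unsplitˡ : Unsplit p
      unsplitʳ : Unsplit q
      inBˡ     : B (proj₁ p)
      inBʳ     : B (proj₁ q)

  open BEdge

  BEdge-sym : Symmetric BEdge
  BEdge-sym (bedge pq up uq Bp Bq) = bedge (swap pq) uq up Bq Bp

  BEdge-lift : ∀ {p q} → BEdge p q → HasEdge E₂ (ιS p) (ιS q)
  BEdge-lift (bedge pq up uq _ _) =
    subst₂ (HasEdge E₂) (rename₂-unsplit up) (rename₂-unsplit uq) (HasEdge-split₂⁺ pq)

  BEdge-from : ∀ {p q} → B (proj₁ p) → Unsplit p → HasEdge E p q → BEdge p q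
  BEdge-from {p} {q} Bp up pq =
    bedge pq up uq Bp (subst (InB₂ ∘ proj₁) (rename₂-unsplit uq) q₂∈B)
    where
    q₂∈B : InB₂ (proj₁ (rename₂ q))
    q₂∈B = Conn-snoc Bp
             (subst (λ t → HasEdge E₂ t (rename₂ q)) (rename₂-unsplit up) (HasEdge-split₂⁺ pq))
    uq : Unsplit q
    uq = InB₂⇒Unsplit q q₂∈B

  BEdge-continues : ∀ {a b} → BEdge a b → proj₁ a ≢ u → proj₁ a ≢ v → ∃ (BEdge (oppS a))
  BEdge-continues ab a≢u a≢v =
    let c , âc = ¬IsTip⇒edge-at E _ (no-tips _ (inBˡ ab) a≢u a≢v) _
    in c , BEdge-from (inBˡ ab) (unsplit-off-ends a≢u a≢v) âc

  BEdge-acyclic : ∀ {a y ys} → LinkedBy BEdge a (y ∷ ys) → proj₁ (lastOf y ys) ≢ proj₁ a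
  BEdge-acyclic {a} {y} {ys} walk@(ay , _) closes =
    no-cycloid (ιS a , ιS y , map ιS ys , (linked , cong (_, _) closes₂) , inside)
    where
    linked : Linked E₂ (ιS a) (ιS y ∷ map ιS ys)
    linked = LinkedBy⇒Linked id (LinkedBy-map ιS (λ _ → refl) BEdge-lift walk)
    closes₂ : proj₁ (lastOf (ιS y) (map ιS ys)) ≡ ι (proj₁ a)
    closes₂ = trans (cong proj₁ (lastOf-map ιS y ys)) (cong ι closes)
    inside : All (InB₂ ∘ proj₁) (map ιS (a ∷ y ∷ ys))
    inside = All-map⁺ (LinkedBy-All inBʳ (inBˡ ay) walk)

  open ExtendToEnds BEdge BEdge-sym u v BEdge-continues BEdge-acyclic

  uv-walk⇒EdgeOfB′ : ∀ {p q s ws} → LinkedBy BEdge s ws → EdgeOn p q s ws →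
                     proj₁ s ≡ u → proj₁ (lastOf s ws) ≡ v → EdgeOfB′ E (u , α) (v , β) p q
  uv-walk⇒EdgeOfB′ {ws = []} _ () _ _
  uv-walk⇒EdgeOfB′ {ws = y ∷ ys} walk@(sy , _) on s≡u t≡v
    with refl ← unsplit-start s≡u (unsplitˡ sy) =
    y ∷ ys , ((LinkedBy⇒Linked edge walk , t≡vβ̂) , LinkedBy⇒Unique walk) , on
    where
    t≡vβ̂ : lastOf y ys ≡ (v , opp β)
    t≡vβ̂ = unsplit-end t≡v (unsplitʳ (proj₂ (LinkedBy-last-step walk)))

  BEdge⇒EdgeOfB′ : ∀ {p q} → BEdge p q → EdgeOfB′ E (u , α) (v , β) p q
  BEdge⇒EdgeOfB′ pq =
    let _ , _ , walk , on , s≡u , t≡v = R⇒WalkFromUToVThrough pq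
    in uv-walk⇒EdgeOfB′ walk on s≡u t≡v

  Linked⇒LinkedBy-BEdge : ∀ a bs → B (proj₁ a) → Unsplit a →
                          All (u ≢_) (map proj₁ bs) → Unique (map proj₁ bs) →
                          proj₁ (lastOf a bs) ≡ v → Linked E a bs → LinkedBy BEdge a bs
  Linked⇒LinkedBy-BEdge a []       _  _  _ _ _ _        = tt
  Linked⇒LinkedBy-BEdge a (b ∷ []) Ba ua _ _ _ (ab , _) = BEdge-from Ba ua ab , tt
  Linked⇒LinkedBy-BEdge a (b ∷ c ∷ cs) Ba ua (u≢b ∷ u∉cs) (b∉cs ∷ unique) t≡v (ab , bs) =
    a→b , Linked⇒LinkedBy-BEdge b (c ∷ cs) (inBʳ a→b) (unsplit-off-ends (u≢b ∘ sym) b≢v)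
            u∉cs unique t≡v bs
    where
    a→b = BEdge-from Ba ua ab
    b≢v : proj₁ b ≢ v
    b≢v b≡v = All.lookup b∉cs (lastOf∈ c cs) (trans b≡v (sym t≡v))

  uv-path⇒LinkedBy-BEdge : ∀ {ws} → IsPath E (u , α) ws (v , opp β) → LinkedBy BEdge (u , α) ws
  uv-path⇒LinkedBy-BEdge {ws} ((linked , t≡vβ̂) , u∉ws ∷ unique) =
    Linked⇒LinkedBy-BEdge (u , α) ws ε unsplit-uα u∉ws unique (cong proj₁ t≡vβ̂) linked
    where
    unsplit-uα : Unsplit (u , α)
    unsplit-uα = opp-irreflexive α ∘ cong proj₂ , u≢v ∘ cong proj₁

  NodeOfB′⇒InB : ∀ {w} → NodeOfB′ E (u , α) (v , β) w → B w
  NodeOfB′⇒InB (inj₁ refl)                   = ε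
  NodeOfB′⇒InB (inj₂ (inj₁ refl))            = proj₁ separable
  NodeOfB′⇒InB (inj₂ (inj₂ (_ , path , on))) =
    All.lookup (All-map⁺ (LinkedBy-All inBʳ ε (uv-path⇒LinkedBy-BEdge path))) on

  EdgeOfB′⇒BEdge : ∀ {p q} → EdgeOfB′ E (u , α) (v , β) p q → BEdge p q
  EdgeOfB′⇒BEdge (_ , path , on) = EdgeOn⇒R BEdge-sym (uv-path⇒LinkedBy-BEdge path) on

  InB⇒NodeOfB′ : ∀ {w} → B w → NodeOfB′ E (u , α) (v , β) w
  InB⇒NodeOfB′ {w} Bw with w ≟F u | w ≟F v
  ... | yes w≡u | _       = inj₁ w≡u
  ... | no _    | yes w≡v = inj₂ (inj₁ w≡v)
  ... | no w≢u  | no w≢v  =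
    let c , wc = ¬IsTip⇒edge-at E w (no-tips w Bw w≢u w≢v) pos
        ws , path , on = BEdge⇒EdgeOfB′ (BEdge-from Bw (unsplit-off-ends w≢u w≢v) wc)
    in inj₂ (inj₂ (ws , path , EdgeOn⇒NodeOn on))

  InB₂⇒old-node : ∀ x → InB₂ x → ∃[ w ] (x ≡ ι w × B w)
  InB₂⇒old-node x x∈B with view x
  ... | ‵fromℕ             = contradiction x∈B u≁v′
  ... | ‵inj₁ ‵fromℕ       = contradiction x∈B u≁u′
  ... | ‵inj₁ (‵inject₁ w) = w , refl , x∈B

  EdgeOfB⇒BEdge : ∀ X Y → EdgeOfB E (u , α) (v , β) X Y →
                  ∃₂ λ p q → X ≡ ιS p × Y ≡ ιS q × BEdge p q
  EdgeOfB⇒BEdge X Y (XY , X∈B , Y∈B) with p , q , pq , refl , refl ← HasEdge-split₂⁻ XY =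
    p , q , rename₂-unsplit up , rename₂-unsplit uq ,
    BEdge-from (subst (InB₂ ∘ proj₁) (rename₂-unsplit up) X∈B) up pq
    where
    up = InB₂⇒Unsplit p X∈B
    uq = InB₂⇒Unsplit q Y∈B

  component-nodes : ∀ x → InB₂ x ⇔ (∃[ w ] (x ≡ ι w × NodeOfB′ E (u , α) (v , β) w))
  component-nodes x = mk⇔
    (λ x∈B → let w , x≡w , w∈B = InB₂⇒old-node x x∈B in w , x≡w , InB⇒NodeOfB′ w∈B)
    (λ { (_ , refl , w∈B′) → NodeOfB′⇒InB w∈B′ })

  component-edges : ∀ X Y → EdgeOfB E (u , α) (v , β) X Y ⇔
                    (∃₂ λ p q → X ≡ ιS p × Y ≡ ιS q × EdgeOfB′ E (u , α) (v , β) p q)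
  component-edges X Y = mk⇔
    (λ XY∈B → let p , q , X≡p , Y≡q , pq = EdgeOfB⇒BEdge X Y XY∈B
              in p , q , X≡p , Y≡q , BEdge⇒EdgeOfB′ pq)
    (λ { (_ , _ , refl , refl , pq∈B′) →
           let pq = EdgeOfB′⇒BEdge pq∈B′ in BEdge-lift pq , inBˡ pq , inBʳ pq })

lemma5 : ∀ {n} (E : Graph n) (u v : Fin n) (α β : Sign) →
    Ultrabubble E (u , α) (v , β) →
    BEqualsB′ E (u , α) (v , β)
lemma5 E u v α β (u≢v , separable , no-tips , no-cycloid , _) = component-nodes , component-edges
  where open UltrabubbleComponent E u v α β u≢v separable no-tips no-cycloid
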